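{- Let $G$ be a finite graph and $A$ a vertex of $G$. The sages win the hat guessing game on $G$ with the hint $A^*$ if and only if they win the hat guessing game on $G$ without hints.
   Context: Hat guessing game: a sage sits at each vertex of a finite graph; hat colors are $H=\{0,1,2\}$; each sage sees only his neighbours' hats and guesses his own color by a deterministic function of the neighbours' colors, fixed in advance; without hints, a strategy is winning if every hat placement has at least one correct guess. Hint $A^*$: sage $A$ gets a hat of one of only two colors, and the excluded color becomes known to $A$ alone at the moment he puts on his hat. Formally, the sages fix a function $f_v$ for each $v\ne A$, and three functions $f_A^{(0)},f_A^{(1)},f_A^{(2)}$ of the neighbours' colors for $A$; the adversary chooses an excluded color $j\in H$ and a placement $C$ with $C(A)\ne j$, and $A$ guesses using $f_A^{(j)}$. The sages win with the hint $A^*$ if they can choose these functions so that for every $j$ and every placement $C$ with $C(A)\neq j$ at least one sage guesses correctly. -}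

module Defs where

open import Data.Nat using (ℕ)
open import Data.Fin using (Fin; _≟_)
open import Data.Bool using (Bool; true; false)
open import Data.Product using (Σ; ∃; _×_; _,_)
open import Relation.Binary.PropositionalEquality using (_≡_)
open import Relation.Nullary using (¬_; yes; no)

H : Set
H = Fin 3

record Graph (n : ℕ) : Set where
  field
    adj   : Fin n → Fin n → Bool
    sym   : ∀ u v → adj u v ≡ adj v u
    irrefl : ∀ v → adj v v ≡ false
open Graph public

Placement : ℕ → Set
Placement n = Fin n → H

Local : ∀ {n} → Graph n → Fin n → (Placement n → H) → Set
Local G v g = ∀ (c c' : Placement _) →
  (∀ u → adj G v u ≡ true → c u ≡ c' u) → g c ≡ g c'

Strategy : ∀ {n} → Graph n → Set
Strategy {n} G = Σ (Fin n → Placement n → H) λ f → ∀ v → Local G v (f v)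

WinsNoHint : ∀ {n} → Graph n → Set
WinsNoHint {n} G = Σ (Strategy G) λ { (f , _) →
  ∀ (c : Placement n) → ∃ λ v → f v c ≡ c v }

-- Guess of sage v when the excluded colour (known only to A) is j:
-- A uses fA j, every other sage uses f v.
hintGuess : ∀ {n} → Fin n → (Fin n → Placement n → H) →
            (H → Placement n → H) → H → Fin n → Placement n → H
hintGuess A f fA j v c with v ≟ A
... | yes _ = fA j c
... | no _  = f v c

-- Winning with the hint A*: functions f_v (v ≠ A; the value of f at A is
-- ignored) and f_A^{(0)}, f_A^{(1)}, f_A^{(2)}, all local, such that for
-- every excluded colour j and every placement c with c A ≠ j some sage
-- guesses correctly.
WinsWithHint : ∀ {n} → Graph n → Fin n → Set
WinsWithHint {n} G A =
  Σ (Strategy G) λ { (f , _) →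
  Σ (H → Placement n → H) λ fA →
    (∀ j → Local G A (fA j)) ×
    (∀ (j : H) (c : Placement n) → ¬ (c A ≡ j) →
       ∃ λ v → hintGuess A f fA j v c ≡ c v) }

-- Ignoring the hint shows one direction.  Conversely, A keeps one guessing
-- function f⁽ʲ⁾ per excluded colour j, and the hint matters only on a
-- placement where every other sage guesses wrong; there each f⁽ʲ⁾ with
-- j ≠ C(A) guesses C(A).  So two of the three functions, with different
-- indices, are right, and the hint-free vote "f⁽¹⁾ if f⁽¹⁾ = f⁽²⁾, else
-- f⁽⁰⁾" is then right as well.
module Submission where

open import Defs hiding (sym)
open import Data.Nat using (ℕ)
open import Data.Fin using (Fin; zero; suc; _≟_)
open import Data.Product using (_×_; _,_; ∃)
open import Data.Sum using (_⊎_; inj₁; inj₂)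
open import Relation.Nullary using (¬_; yes; no; contradiction)
open import Relation.Binary.PropositionalEquality using (_≡_; refl; sym; trans)

pattern 0F = zero
pattern 1F = suc zero
pattern 2F = suc (suc zero)

∀⊎⇒⊎∀ : ∀ {n} {P : Set} {Q : Fin n → Set} → (∀ i → P ⊎ Q i) → P ⊎ (∀ i → Q i)
∀⊎⇒⊎∀ {ℕ.zero} h = inj₂ λ ()
∀⊎⇒⊎∀ {ℕ.suc n} h with h zero | ∀⊎⇒⊎∀ (λ i → h (suc i))
... | inj₁ p | _       = inj₁ p
... | inj₂ _ | inj₁ p  = inj₁ p
... | inj₂ q | inj₂ qs = inj₂ λ { zero → q ; (suc i) → qs i }

vote : H → H → H → H
vote x y z with y ≟ z
... | yes _ = y
... | no _  = x

vote-agrees : ∀ (g : H → H) a → (∀ j → ¬ a ≡ j → g j ≡ a) →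
              vote (g 0F) (g 1F) (g 2F) ≡ a
vote-agrees g 0F h rewrite h 1F (λ ()) | h 2F (λ ()) = refl
vote-agrees g 1F h rewrite h 0F (λ ()) | h 2F (λ ()) with g 1F
... | 0F = refl
... | 1F = refl
... | 2F = refl
vote-agrees g 2F h rewrite h 0F (λ ()) | h 1F (λ ()) with g 2F
... | 0F = refl
... | 1F = refl
... | 2F = refl

module _ {n : ℕ} where

  _[_≔_] : (Fin n → Placement n → H) → Fin n → (Placement n → H) →
           Fin n → Placement n → H
  (f [ A ≔ g ]) v with v ≟ A
  ... | yes _ = g
  ... | no _  = f v

  override-local : ∀ (G : Graph n) {f A g} → (∀ v → Local G v (f v)) →
                   Local G A g → ∀ v → Local G v ((f [ A ≔ g ]) v)
  override-local G {A = A} f-local g-local v with v ≟ A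
  ... | yes refl = g-local
  ... | no _     = f-local v

  override-at : ∀ f A g c → (f [ A ≔ g ]) A c ≡ g c
  override-at f A g c with A ≟ A
  ... | yes _  = refl
  ... | no A≢A = contradiction refl A≢A

  override-self : ∀ f A v c → (f [ A ≔ f A ]) v c ≡ f v c
  override-self f A v c with v ≟ A
  ... | yes refl = refl
  ... | no _     = refl

  override-correct : ∀ f A g v c → (f [ A ≔ g ]) v c ≡ c v →
                     g c ≡ c A ⊎ (∀ g′ → (f [ A ≔ g′ ]) v c ≡ c v)
  override-correct f A g v c correct with v ≟ A
  ... | yes refl = inj₁ correct
  ... | no _     = inj₂ λ _ → correct

  hintGuess-override : ∀ A f fA j v c → hintGuess A f fA j v c ≡ (f [ A ≔ fA j ]) v c
  hintGuess-override A f fA j v c with v ≟ A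
  ... | yes _ = refl
  ... | no _  = refl

module _ {n : ℕ} (G : Graph n) (A : Fin n) where

  hint-dispensable : WinsWithHint G A → WinsNoHint G
  hint-dispensable ((f , f-local) , fA , fA-local , win) = (s , s-local) , wins
    where
    voteA : Placement n → H
    voteA c = vote (fA 0F c) (fA 1F c) (fA 2F c)

    voteA-local : Local G A voteA
    voteA-local c c′ same
      rewrite fA-local 0F c c′ same | fA-local 1F c c′ same | fA-local 2F c c′ same = refl

    s : Fin n → Placement n → H
    s = f [ A ≔ voteA ]

    s-local : ∀ v → Local G v (s v)
    s-local = override-local G f-local voteA-local

    s-wins-or-fA-right : ∀ c j → (∃ λ v → s v c ≡ c v) ⊎ (¬ c A ≡ j → fA j c ≡ c A)
    s-wins-or-fA-right c j with c A ≟ j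
    ... | yes cA≡j = inj₂ (contradiction cA≡j)
    ... | no cA≢j with win j c cA≢j
    ... | v , correct
        with override-correct f A (fA j) v c (trans (sym (hintGuess-override A f fA j v c)) correct)
    ... | inj₁ fA-right = inj₂ λ _ → fA-right
    ... | inj₂ v-right  = inj₁ (v , v-right voteA)

    wins : ∀ c → ∃ λ v → s v c ≡ c v
    wins c with ∀⊎⇒⊎∀ (s-wins-or-fA-right c)
    ... | inj₁ someone = someone
    ... | inj₂ fA-right =
      A , trans (override-at f A voteA c) (vote-agrees (λ j → fA j c) (c A) fA-right)

  hint-ignorable : WinsNoHint G → WinsWithHint G A
  hint-ignorable ((f , f-local) , wins) =
    (f , f-local) , (λ _ → f A) , (λ _ → f-local A) , wins-ignoring-hint
    where
    wins-ignoring-hint : ∀ j c → ¬ c A ≡ j → ∃ λ v → hintGuess A f (λ _ → f A) j v c ≡ c v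
    wins-ignoring-hint j c _ with wins c
    ... | v , correct =
      v , trans (hintGuess-override A f (λ _ → f A) j v c) (trans (override-self f A v c) correct)

theorem16 : ∀ {n : ℕ} (G : Graph n) (A : Fin n) →
    (WinsWithHint G A → WinsNoHint G) × (WinsNoHint G → WinsWithHint G A)
theorem16 G A = hint-dispensable G A , hint-ignorable G A
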